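{- For $r\ge1$ and $\alpha^1,\dots,\alpha^r\in\mathrm{ord}$, we have $\sup(\alpha^1,\dots,\alpha^r)<\mathrm S(\alpha^j)_{j\in\{1,\dots,r\}}$.
   Context: The setting is constructive. Let $\mathfrak F$ be a set of index sets containing $\mathbb N$ and every $\mathbb N_k=\{n\in\mathbb N:n<k\}$, closed (up to isomorphism) under finitely enumerated subsets, sets of finitely enumerated subsets, and disjoint unions indexed by elements of $\mathfrak F$. The set $\mathrm{ord}=\mathrm{ord}_{\mathfrak F}$ is defined inductively: a distinguished element $\underline 0$, and for every $I\in\mathfrak F$ and family $(\alpha_i)_{i\in I}$ in $\mathrm{ord}$ an element $\mathrm S(\alpha_i)_{i\in I}$; $\mathrm{ord}^*$ is the set of these. For $\alpha=\mathrm S(\alpha_i)_{i\in I}$, $\mathrm{In}_\alpha=I$; by convention $\mathrm{In}_{\underline0}=\emptyset$. For a finite list $F\subseteq_f\mathrm{In}_\alpha$, $\alpha_F$ is the list of the $\alpha_i$, $i\in F$. By simultaneous induction ($m\ge1$): $\alpha\le\beta^1,\dots,\beta^m$ means $\alpha_i<\beta^1,\dots,\beta^m$ for all $i\in\mathrm{In}_\alpha$; $\alpha<\beta^1,\dots,\beta^m$ means there exist $F_k\subseteq_f\mathrm{In}_{\beta^k}$, not all empty, with $\alpha\le\beta^1_{F_1},\dots,\beta^m_{F_m}$. For a family $(\alpha^j)_{j\in J}$ in $\mathrm{ord}^*$ with $\alpha^j=\mathrm S((\alpha^j)_i)_{i\in I_j}$, $\sup(\alpha^j)_{j\in J}=\mathrm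 S(\varepsilon_k)_{k\in K}$ where $K$ is the disjoint union of the $I_j$ and $\varepsilon_k=(\alpha^j)_i$ when $k$ is the image of $i\in I_j$; for a finite family in $\mathrm{ord}$, $\sup(\alpha^1,\dots,\alpha^r)$ is $\underline0$ if all $\alpha^k=\underline 0$, else the sup of those $\alpha^k\in\mathrm{ord}^*$. -}

module Defs where

open import Data.Nat using (ℕ; zero; suc)
open import Data.Fin using (Fin)
open import Data.List using (List; []; _∷_; length; map; _++_; filter; lookup; allFin)
open import Data.List.Relation.Unary.All using (All; []; _∷_)
open import Data.Product using (Σ; _,_; proj₁; proj₂)
open import Data.Sum using (_⊎_)
open import Data.Empty using (⊥)
open import Data.Unit using (⊤; tt)
open import Relation.Nullary using (¬_; yes; no)
open import Relation.Unary using (Decidable)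
open import Relation.Binary.PropositionalEquality using (_≢_)
open import Function using (_∘_)
open import Function.Bundles using (_↔_; Inverse)

-- The family 𝔉 of index sets, as a universe of codes `U` decoded by
-- `El`, with the closure properties (up to isomorphism) of the paper.

record IndexFamily : Set₁ where
  field
    U  : Set
    El : U → Set
    ℕᶜ     : U
    ℕᶜ-iso : El ℕᶜ ↔ ℕ
    Finᶜ     : ℕ → U
    Finᶜ-iso : (k : ℕ) → El (Finᶜ k) ↔ Fin k
    -- finitely enumerated subsets {x₀,…,x_{n-1}} of an index set,
    -- enumerated by ℕ_n
    Subᶜ     : (a : U) → List (El a) → U
    Subᶜ-iso : (a : U) (l : List (El a)) → El (Subᶜ a l) ↔ Fin (length l)
    PFinᶜ     : U → U
    PFinᶜ-iso : (a : U) → El (PFinᶜ a) ↔ List (El a)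
    Σᶜ     : (a : U) → (El a → U) → U
    Σᶜ-iso : (a : U) (b : El a → U) → El (Σᶜ a b) ↔ Σ (El a) (El ∘ b)

module _ (𝔉 : IndexFamily) where
  open IndexFamily 𝔉

  data Ord : Set where
    𝟘 : Ord
    S : (I : U) → (El I → Ord) → Ord

  IsS : Ord → Set
  IsS 𝟘       = ⊥
  IsS (S _ _) = ⊤

  IsS? : (α : Ord) → Relation.Nullary.Dec (IsS α)
  IsS? 𝟘       = no (λ ())
  IsS? (S _ _) = yes tt

  In : Ord → Set
  In 𝟘       = ⊥
  In (S I _) = El I

  comp : (α : Ord) → In α → Ord
  comp 𝟘 ()
  comp (S _ f) i = f i

  Sel : List Ord → Set
  Sel = All (λ β → List (In β))

  pick : (βs : List Ord) → Sel βs → List Ord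
  pick []       []       = []
  pick (β ∷ βs) (F ∷ Fs) = map (comp β) F ++ pick βs Fs

  NotAllEmpty : (βs : List Ord) → Sel βs → Set
  NotAllEmpty []       []       = ⊥
  NotAllEmpty (β ∷ βs) (F ∷ Fs) = (F ≢ []) ⊎ NotAllEmpty βs Fs

  data _≤ᵒ_ (α : Ord) (βs : List Ord) : Set
  data _<ᵒ_ (α : Ord) (βs : List Ord) : Set

  data _≤ᵒ_ α βs where
    le : ((i : In α) → comp α i <ᵒ βs) → α ≤ᵒ βs

  data _<ᵒ_ α βs where
    lt : (Fs : Sel βs) → NotAllEmpty βs Fs → α ≤ᵒ pick βs Fs → α <ᵒ βs

  infix 4 _≤ᵒ_ _<ᵒ_

  -- index code of an element of ord* (dummy empty code ℕ_0 for 0,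
  -- never used on 0 below)
  code : Ord → U
  code 𝟘       = Finᶜ 0
  code (S I _) = I

  comp' : (α : Ord) → El (code α) → Ord
  comp' 𝟘 x with Inverse.to (Finᶜ-iso 0) x
  ... | ()
  comp' (S _ f) i = f i

  -- sup (α^j)_{j∈J} for a family in ord* indexed by J ∈ 𝔉:
  -- S (ε_k)_{k∈K}, K = disjoint union of the In_{α^j}
  supFam : (J : U) → (El J → Ord) → Ord
  supFam J α = S (Σᶜ J (λ j → code (α j))) ε
    where
    ε : El (Σᶜ J (λ j → code (α j))) → Ord
    ε k with Inverse.to (Σᶜ-iso J (λ j → code (α j))) k
    ... | j , i = comp' (α j) i

  nzIdx : (r : ℕ) → (Fin r → Ord) → List (El (Finᶜ r))
  nzIdx r α = filter (λ e → IsS? (α (Inverse.to (Finᶜ-iso r) e)))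
                     (map (Inverse.from (Finᶜ-iso r)) (allFin r))

  supFin : (r : ℕ) → (Fin r → Ord) → Ord
  supFin r α with nzIdx r α
  ... | []    = 𝟘
  ... | l@(_ ∷ _) =
    supFam (Subᶜ (Finᶜ r) l)
           (λ j → α (Inverse.to (Finᶜ-iso r)
                      (lookup l (Inverse.to (Subᶜ-iso (Finᶜ r) l) j))))

  SFin : (r : ℕ) → (Fin r → Ord) → Ord
  SFin r α = S (Finᶜ r) (α ∘ Inverse.to (Finᶜ-iso r))

-- Every component of sup(α¹,…,αʳ) is a component of some nonzero αʲ, hence
-- below αʲ; selecting from S(αʲ)ⱼ the indices j with αʲ ≠ 0 therefore bounds
-- every component of the sup. If all αʲ are 0 the sup is 0, which has no
-- components and so lies below any nonempty selection; this needs r ≥ 1.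
module Submission where

open import Defs
open import Data.Nat using (ℕ; suc; _≤_; s≤s; z≤n)
open import Data.Fin using (Fin; zero)
open import Data.List using (List; _∷_; []; _++_; map; lookup; length)
open import Data.List.Relation.Unary.All using ([]; _∷_)
open import Data.List.Relation.Unary.Any using (here; there)
open import Data.List.Membership.Propositional using (_∈_)
open import Data.List.Membership.Propositional.Properties using (∈-map⁺; ∈-lookup)
open import Data.List.Properties using (++-identityʳ)
open import Data.Product using (_,_)
open import Data.Sum using (inj₁; inj₂; fromInj₁)
open import Relation.Binary.PropositionalEquality using (_≡_; _≢_; refl; subst; sym)
open import Function.Bundles using (Inverse)

module _ {𝔉 : IndexFamily} where
  open IndexFamily 𝔉

  emptySel : (βs : List (Ord 𝔉)) → Sel 𝔉 βs
  emptySel []       = []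
  emptySel (_ ∷ βs) = [] ∷ emptySel βs

  pick-emptySel : (βs : List (Ord 𝔉)) → pick 𝔉 βs (emptySel βs) ≡ []
  pick-emptySel []       = refl
  pick-emptySel (_ ∷ βs) = pick-emptySel βs

  <ᵒ-singleton : ∀ {α β} (F : List (In 𝔉 β)) → F ≢ [] →
                 _≤ᵒ_ 𝔉 α (map (comp 𝔉 β) F) → _<ᵒ_ 𝔉 α (β ∷ [])
  <ᵒ-singleton {α} {β} F F≢[] α≤ =
    lt (F ∷ []) (inj₁ F≢[]) (subst (_≤ᵒ_ 𝔉 α) (sym (++-identityʳ (map (comp 𝔉 β) F))) α≤)

  𝟘-≤ᵒ : (βs : List (Ord 𝔉)) → _≤ᵒ_ 𝔉 𝟘 βs
  𝟘-≤ᵒ _ = le λ ()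

  𝟘-<ᵒ : ∀ {β} → In 𝔉 β → _<ᵒ_ 𝔉 𝟘 (β ∷ [])
  𝟘-<ᵒ i = <ᵒ-singleton (i ∷ []) (λ ()) (𝟘-≤ᵒ _)

  ≤ᵒ-refl : (γ : Ord 𝔉) → _≤ᵒ_ 𝔉 γ (γ ∷ [])
  ≤ᵒ-refl 𝟘       = 𝟘-≤ᵒ _
  ≤ᵒ-refl (S _ f) = le λ i → <ᵒ-singleton (i ∷ []) (λ ()) (≤ᵒ-refl (f i))

  comp'-<ᵒ : (γ : Ord 𝔉) (i : El (code 𝔉 γ)) → _<ᵒ_ 𝔉 (comp' 𝔉 γ i) (γ ∷ [])
  comp'-<ᵒ 𝟘 i with () ← Inverse.to (Finᶜ-iso 0) i
  comp'-<ᵒ (S _ f) i = <ᵒ-singleton (i ∷ []) (λ ()) (≤ᵒ-refl (f i))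

  <ᵒ-∈ : ∀ {α β βs} → β ∈ βs → _<ᵒ_ 𝔉 α (β ∷ []) → _<ᵒ_ 𝔉 α βs
  <ᵒ-∈ {α} {βs = β ∷ βs} (here refl) (lt (F ∷ []) F≢[] α≤) =
    lt (F ∷ emptySel βs) (inj₁ (fromInj₁ (λ ()) F≢[]))
       (subst (λ γs → _≤ᵒ_ 𝔉 α (map (comp 𝔉 β) F ++ γs)) (sym (pick-emptySel βs)) α≤)
  <ᵒ-∈ (there β∈βs) α<β with lt Fs nonempty α≤ ← <ᵒ-∈ β∈βs α<β = lt ([] ∷ Fs) (inj₂ nonempty) α≤

  supFam-≤ᵒ : ∀ J (α : El J → Ord 𝔉) {βs} → (∀ j → α j ∈ βs) → _≤ᵒ_ 𝔉 (supFam 𝔉 J α) βs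
  supFam-≤ᵒ J α {βs} α∈βs = le component<
    where
    component< : ∀ k → _<ᵒ_ 𝔉 (comp 𝔉 (supFam 𝔉 J α) k) βs
    component< k with Inverse.to (Σᶜ-iso J (λ j → code 𝔉 (α j))) k
    ... | j , i = <ᵒ-∈ (α∈βs j) (comp'-<ᵒ (α j) i)

lemma4p1 : (𝔉 : IndexFamily) (r : ℕ) → 1 ≤ r → (α : Fin r → Ord 𝔉) →
    _<ᵒ_ 𝔉 (supFin 𝔉 r α) (SFin 𝔉 r α ∷ [])
lemma4p1 𝔉 (suc r) (s≤s z≤n) α with nzIdx 𝔉 (suc r) α
... | [] = 𝟘-<ᵒ (Inverse.from (IndexFamily.Finᶜ-iso 𝔉 (suc r)) zero)
... | l@(_ ∷ _) = <ᵒ-singleton l (λ ()) (supFam-≤ᵒ _ _ λ j → ∈-map⁺ _ (∈-lookup (position j)))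
  where
  open IndexFamily 𝔉
  position : El (Subᶜ (Finᶜ (suc r)) l) → Fin (length l)
  position = Inverse.to (Subᶜ-iso (Finᶜ (suc r)) l)
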